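{- Let $E_1,E_2$ be two linear p-types, or two bang p-types, such that $E_1^-=E_2^-$. Then $\mathcal U(E_1,E_2)$ is defined. Moreover, for every instantiation $\phi$ admissible for both $E_1$ and $E_2$, we have $\phi(E_1)=\phi(E_2)$ if and only if $\phi$ is a solution of $\mathcal U(E_1,E_2)$.
   Context: $DLAL\star$ types: linear $A ::= \alpha\mid D\multimap A\mid\forall\alpha.A\mid\S A$, arbitrary $D ::= A\mid !A$. Parameters: integer parameters $\mathsf m,\mathsf n,\dots$ (ranging over $\mathbb Z$), boolean parameters $\mathsf b,\dots$ (over $\{0,1\}$), linear combinations $\mathsf c=\mathsf n_1+\dots+\mathsf n_k$ ($k\ge0$). P-types: $F ::= \alpha\mid D\multimap A\mid\forall\alpha.A$, linear p-types $A ::= \S^{\mathsf c}F$, bang p-types $D ::= \S^{\mathsf b,\mathsf c}F$. The erasure $E^-$ of a p-type forgets modalities and parameters and maps $\multimap$ to $\to$ (giving a system F type). An instantiation $\phi=(\phi^b,\phi^i)$ maps boolean parameters to $\{0,1\}$ and integer parameters to $\mathbb Z$, extended additively to linear combinations; it is admissible for $E$ if $\phi^i(\mathsf c)\ge0$ for every $\mathsf c$ in $E$ and $\phi^b(\mathsf b)=1\Rightarrow\phi^i(\mathsf c)\ge1$ whenever $\S^{\mathsf b,\mathsf c}F$ occurs in $E$. Then $\phi(\S^{\mathsf c}F)=\S^{\phi^i(\mathsf c)}\phi(F)$; $\phi(\S^{\mathsf b,\mathsf c}F)=\S^{\phi^i(\mathsf c)}\phi(F)$ if $\phi^b(\mathsf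 b)=0$, $=!\S^{\phi^i(\mathsf c)-1}\phi(F)$ otherwise; $\phi$ commutes with other connectives. The constraint set $\mathcal U(E_1,E_2)$: $\mathcal U(\alpha,\alpha)=\emptyset$; $\mathcal U(D_1\multimap A_1,D_2\multimap A_2)=\mathcal U(D_1,D_2)\cup\mathcal U(A_1,A_2)$; $\mathcal U(\forall\alpha.A_1,\forall\alpha.A_2)=\mathcal U(A_1,A_2)$; $\mathcal U(\S^{\mathsf c_1}F_1,\S^{\mathsf c_2}F_2)=\{\mathsf c_1=\mathsf c_2\}\cup\mathcal U(F_1,F_2)$; $\mathcal U(\S^{\mathsf b_1,\mathsf c_1}F_1,\S^{\mathsf b_2,\mathsf c_2}F_2)=\{\mathsf b_1=\mathsf b_2,\mathsf c_1=\mathsf c_2\}\cup\mathcal U(F_1,F_2)$; undefined otherwise. $\phi$ is a solution if it satisfies every equation in it. -}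

module Defs where

open import Data.Nat using (ℕ; zero; suc; _∸_; _≟_)
open import Data.Integer using (ℤ; +_; ∣_∣; _≤_) renaming (_+_ to _+ℤ_)
open import Data.Bool using (Bool; true; false)
open import Data.List using (List; []; _∷_; _++_; foldr)
open import Data.List.Relation.Unary.All using (All)
open import Data.Maybe using (Maybe; just; nothing)
open import Data.Product using (_×_)
open import Data.Unit using (⊤)
open import Relation.Binary.PropositionalEquality using (_≡_)
open import Relation.Nullary using (yes; no)

-- Type variables are named by natural numbers (binders are named).

TVar : Set
TVar = ℕ

-- System F types (targets of erasure)
data SF : Set where
  var  : TVar → SF
  _⇒_  : SF → SF → SF
  all  : TVar → SF → SF

-- DLAL* types:  linear A ::= α | D ⊸ A | ∀α.A | §A ;  arbitrary D ::= A | !A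
mutual
  data LTy : Set where
    tvar : TVar → LTy
    _⊸_  : DTy → LTy → LTy
    tall : TVar → LTy → LTy
    §_   : LTy → LTy

  data DTy : Set where
    lin  : LTy → DTy
    bang : LTy → DTy

§^ : ℕ → LTy → LTy
§^ zero    A = A
§^ (suc n) A = § (§^ n A)

IntParam : Set
IntParam = ℕ

BoolParam : Set
BoolParam = ℕ

-- linear combination n₁ + … + nₖ (k ≥ 0) of integer parameters
LinComb : Set
LinComb = List IntParam

-- P-types:  F ::= α | D ⊸ A | ∀α.A ;  A ::= §^c F ;  D ::= §^{b,c} F
mutual
  data PF : Set where
    pvar : TVar → PF
    _⊸ₚ_ : PD → PA → PF
    pall : TVar → PA → PF

  data PA : Set where
    §ᶜ : LinComb → PF → PA

  data PD : Set where
    §ᵇᶜ : BoolParam → LinComb → PF → PD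

mutual
  eraseF : PF → SF
  eraseF (pvar α)  = var α
  eraseF (D ⊸ₚ A)  = eraseD D ⇒ eraseA A
  eraseF (pall α A) = all α (eraseA A)

  eraseA : PA → SF
  eraseA (§ᶜ c F) = eraseF F

  eraseD : PD → SF
  eraseD (§ᵇᶜ b c F) = eraseF F

record Inst : Set where
  field
    φb : BoolParam → Bool
    φi : IntParam → ℤ
open Inst public

evalC : Inst → LinComb → ℤ
evalC φ c = foldr (λ n acc → φi φ n +ℤ acc) (+ 0) c

mutual
  AdmF : Inst → PF → Set
  AdmF φ (pvar α)   = ⊤
  AdmF φ (D ⊸ₚ A)   = AdmD φ D × AdmA φ A
  AdmF φ (pall α A) = AdmA φ A

  AdmA : Inst → PA → Set
  AdmA φ (§ᶜ c F) = (+ 0 ≤ evalC φ c) × AdmF φ F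

  AdmD : Inst → PD → Set
  AdmD φ (§ᵇᶜ b c F) =
    (+ 0 ≤ evalC φ c) × (φb φ b ≡ true → + 1 ≤ evalC φ c) × AdmF φ F

-- application of φ (meaningful for admissible φ, where φ(c) ≥ 0,
-- so that ∣ φ(c) ∣ = φ(c); and φ(c) ≥ 1 when φ(b) = 1)
mutual
  instF : Inst → PF → LTy
  instF φ (pvar α)   = tvar α
  instF φ (D ⊸ₚ A)   = instD φ D ⊸ instA φ A
  instF φ (pall α A) = tall α (instA φ A)

  instA : Inst → PA → LTy
  instA φ (§ᶜ c F) = §^ ∣ evalC φ c ∣ (instF φ F)

  instD : Inst → PD → DTy
  instD φ (§ᵇᶜ b c F) with φb φ b
  ... | false = lin  (§^ ∣ evalC φ c ∣ (instF φ F))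
  ... | true  = bang (§^ (∣ evalC φ c ∣ ∸ 1) (instF φ F))

data Constraint : Set where
  eqC : LinComb → LinComb → Constraint
  eqB : BoolParam → BoolParam → Constraint

Sat : Inst → Constraint → Set
Sat φ (eqC c₁ c₂) = evalC φ c₁ ≡ evalC φ c₂
Sat φ (eqB b₁ b₂) = φb φ b₁ ≡ φb φ b₂

Solution : Inst → List Constraint → Set
Solution φ C = All (Sat φ) C

private
  _∪_ : Maybe (List Constraint) → Maybe (List Constraint) → Maybe (List Constraint)
  just x ∪ just y = just (x ++ y)
  _      ∪ _      = nothing

  _∷ₘ_ : Constraint → Maybe (List Constraint) → Maybe (List Constraint)
  k ∷ₘ just x  = just (k ∷ x)
  k ∷ₘ nothing = nothing

-- 𝒰(E₁,E₂); `nothing` means "undefined"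
mutual
  𝒰F : PF → PF → Maybe (List Constraint)
  𝒰F (pvar α) (pvar β) with α ≟ β
  ... | yes _ = just []
  ... | no  _ = nothing
  𝒰F (D₁ ⊸ₚ A₁) (D₂ ⊸ₚ A₂) = 𝒰D D₁ D₂ ∪ 𝒰A A₁ A₂
  𝒰F (pall α A₁) (pall β A₂) with α ≟ β
  ... | yes _ = 𝒰A A₁ A₂
  ... | no  _ = nothing
  𝒰F _ _ = nothing

  𝒰A : PA → PA → Maybe (List Constraint)
  𝒰A (§ᶜ c₁ F₁) (§ᶜ c₂ F₂) = eqC c₁ c₂ ∷ₘ 𝒰F F₁ F₂

  𝒰D : PD → PD → Maybe (List Constraint)
  𝒰D (§ᵇᶜ b₁ c₁ F₁) (§ᵇᶜ b₂ c₂ F₂) = eqB b₁ b₂ ∷ₘ (eqC c₁ c₂ ∷ₘ 𝒰F F₁ F₂)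

-- Equal erasures mean E₁ and E₂ have the same shape, so 𝒰 recurses through
-- both in lockstep and is defined. Since φ(F) never starts with §, the
-- instance φ(§^c F) determines both φ(F) and the number ∣φ(c)∣ of leading §'s,
-- which determines φ(c) because admissibility makes it non-negative. For a
-- bang p-type the outer lin/bang also determines φ(b), and when φ(b) = 1
-- admissibility gives φ(c) ≥ 1, so the truncated ∣φ(c)∣ ∸ 1 still determines
-- φ(c). Hence φ(E₁) = φ(E₂) exactly when φ equates the parameters that 𝒰 pairs.
module Submission where

open import Defs
open import Data.Bool using (Bool; true; false)
open import Data.Empty using (⊥)
open import Data.Integer using (ℤ; +_; ∣_∣; _≤_; +≤+)
open import Data.Integer.Properties using (0≤i⇒+∣i∣≡i)
open import Data.List using (List; []; _∷_; _++_)
open import Data.List.Relation.Unary.All using (All; []; _∷_; uncons)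
open import Data.List.Relation.Unary.All.Properties using (++↔)
open import Data.Maybe using (Maybe; just)
open import Data.Nat using (ℕ; zero; suc; _∸_; _≟_; s≤s)
import Data.Nat as ℕ
open import Data.Product using (_×_; ∃; _,_; proj₁; proj₂; uncurry)
open import Data.Unit using (⊤; tt)
open import Data.Product.Function.NonDependent.Propositional using (_×-⇔_)
open import Function.Bundles using (_⇔_; mk⇔)
open import Function.Related.Propositional using (module EquationalReasoning)
import Function.Properties.Equivalence as ⇔
open import Function.Properties.Inverse using (↔⇒⇔)
open import Relation.Binary.PropositionalEquality
  using (_≡_; refl; sym; trans; cong; cong₂)
open import Relation.Nullary using (yes; no; contradiction)

private
  variable
    φ : Inst
    b₁ b₂ : Bool
    m n : ℕ
    i j : ℤ
    X Y : LTy
    c₁ c₂ : LinComb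
    F₁ F₂ : PF

Unboxed : LTy → Set
Unboxed (§ _) = ⊥
Unboxed _     = ⊤

instF-unboxed : ∀ φ F → Unboxed (instF φ F)
instF-unboxed φ (pvar _)   = tt
instF-unboxed φ (_ ⊸ₚ _)   = tt
instF-unboxed φ (pall _ _) = tt

§-injective : § X ≡ § Y → X ≡ Y
§-injective refl = refl

lin-injective : lin X ≡ lin Y → X ≡ Y
lin-injective refl = refl

bang-injective : bang X ≡ bang Y → X ≡ Y
bang-injective refl = refl

⊸-≡-⇔ : ∀ {D₁ D₂ A₁ A₂} → (D₁ ⊸ A₁ ≡ D₂ ⊸ A₂) ⇔ (D₁ ≡ D₂ × A₁ ≡ A₂)
⊸-≡-⇔ = mk⇔ (λ { refl → refl , refl }) (uncurry (cong₂ _⊸_))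

tall-≡-⇔ : ∀ {α A₁ A₂} → (tall α A₁ ≡ tall α A₂) ⇔ (A₁ ≡ A₂)
tall-≡-⇔ {α} = mk⇔ (λ { refl → refl }) (cong (tall α))

⇒-injective : ∀ {S₁ S₂ T₁ T₂} → S₁ ⇒ T₁ ≡ S₂ ⇒ T₂ → S₁ ≡ S₂ × T₁ ≡ T₂
⇒-injective refl = refl , refl

all-injective : ∀ {α β S T} → all α S ≡ all β T → α ≡ β × S ≡ T
all-injective refl = refl , refl

§^-injective : ∀ m n → Unboxed X → Unboxed Y → §^ m X ≡ §^ n Y → m ≡ n × X ≡ Y
§^-injective zero    zero    _  _  X≡Y = refl , X≡Y
§^-injective zero    (suc n) () _  refl
§^-injective (suc m) zero    _  () refl
§^-injective (suc m) (suc n) uX uY e with §^-injective m n uX uY (§-injective e)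
... | refl , X≡Y = refl , X≡Y

§^-≡-⇔ : Unboxed X → Unboxed Y → (§^ m X ≡ §^ n Y) ⇔ (m ≡ n × X ≡ Y)
§^-≡-⇔ {m = m} {n = n} uX uY =
  mk⇔ (§^-injective m n uX uY) (uncurry (cong₂ §^))

-- φ(§^{b,c} F) in terms of φ(b), ∣φ(c)∣ and φ(F); note the truncated n ∸ 1.
§ᵇ^ : Bool → ℕ → LTy → DTy
§ᵇ^ false n X = lin  (§^ n X)
§ᵇ^ true  n X = bang (§^ (n ∸ 1) X)

instD≡§ᵇ^ : ∀ φ b c F → instD φ (§ᵇᶜ b c F) ≡ §ᵇ^ (φb φ b) ∣ evalC φ c ∣ (instF φ F)
instD≡§ᵇ^ φ b c F with φb φ b
... | false = refl
... | true  = refl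

§ᵇ^-injective : ∀ {b₁ b₂ m n X Y} → Unboxed X → Unboxed Y →
  (b₁ ≡ true → 1 ℕ.≤ m) → (b₂ ≡ true → 1 ℕ.≤ n) →
  §ᵇ^ b₁ m X ≡ §ᵇ^ b₂ n Y → b₁ ≡ b₂ × m ≡ n × X ≡ Y
§ᵇ^-injective {false} {false} {m} {n} uX uY _ _ e =
  refl , §^-injective m n uX uY (lin-injective e)
§ᵇ^-injective {false} {true}  _ _ _ _ ()
§ᵇ^-injective {true}  {false} _ _ _ _ ()
§ᵇ^-injective {true} {true} uX uY 1≤m 1≤n e with 1≤m refl | 1≤n refl
... | s≤s _ | s≤s _ with §^-injective _ _ uX uY (bang-injective e)
...   | refl , X≡Y = refl , refl , X≡Y

§ᵇ^-≡-⇔ : Unboxed X → Unboxed Y →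
  (b₁ ≡ true → 1 ℕ.≤ m) → (b₂ ≡ true → 1 ℕ.≤ n) →
  (§ᵇ^ b₁ m X ≡ §ᵇ^ b₂ n Y) ⇔ (b₁ ≡ b₂ × m ≡ n × X ≡ Y)
§ᵇ^-≡-⇔ uX uY 1≤m 1≤n = mk⇔ (§ᵇ^-injective uX uY 1≤m 1≤n) λ { (refl , refl , refl) → refl }

∣i∣≡∣j∣⇔i≡j : + 0 ≤ i → + 0 ≤ j → (∣ i ∣ ≡ ∣ j ∣) ⇔ (i ≡ j)
∣i∣≡∣j∣⇔i≡j 0≤i 0≤j = mk⇔
  (λ e → trans (sym (0≤i⇒+∣i∣≡i 0≤i)) (trans (cong +_ e) (0≤i⇒+∣i∣≡i 0≤j)))
  (cong ∣_∣)

1≤i⇒1≤∣i∣ : + 1 ≤ i → 1 ℕ.≤ ∣ i ∣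
1≤i⇒1≤∣i∣ (+≤+ 1≤n) = 1≤n

instA-≡-⇔ : + 0 ≤ evalC φ c₁ → + 0 ≤ evalC φ c₂ →
  (instA φ (§ᶜ c₁ F₁) ≡ instA φ (§ᶜ c₂ F₂)) ⇔
  (evalC φ c₁ ≡ evalC φ c₂ × instF φ F₁ ≡ instF φ F₂)
instA-≡-⇔ {φ = φ} {F₁ = F₁} {F₂ = F₂} 0≤c₁ 0≤c₂ =
  ⇔.trans (§^-≡-⇔ (instF-unboxed φ F₁) (instF-unboxed φ F₂))
          (∣i∣≡∣j∣⇔i≡j 0≤c₁ 0≤c₂ ×-⇔ ⇔.refl)

instD-≡-⇔ : ∀ {b₁ b₂ : BoolParam} → AdmD φ (§ᵇᶜ b₁ c₁ F₁) → AdmD φ (§ᵇᶜ b₂ c₂ F₂) →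
  (instD φ (§ᵇᶜ b₁ c₁ F₁) ≡ instD φ (§ᵇᶜ b₂ c₂ F₂)) ⇔
  (φb φ b₁ ≡ φb φ b₂ × evalC φ c₁ ≡ evalC φ c₂ × instF φ F₁ ≡ instF φ F₂)
instD-≡-⇔ {φ = φ} {c₁ = c₁} {F₁ = F₁} {c₂ = c₂} {F₂ = F₂} {b₁} {b₂}
  (0≤c₁ , 1≤c₁ , _) (0≤c₂ , 1≤c₂ , _) = begin
  (instD φ (§ᵇᶜ b₁ c₁ F₁) ≡ instD φ (§ᵇᶜ b₂ c₂ F₂))
    ≡⟨ cong₂ _≡_ (instD≡§ᵇ^ φ b₁ c₁ F₁) (instD≡§ᵇ^ φ b₂ c₂ F₂) ⟩
  (§ᵇ^ (φb φ b₁) (∣ evalC φ c₁ ∣) (instF φ F₁) ≡ §ᵇ^ (φb φ b₂) (∣ evalC φ c₂ ∣) (instF φ F₂))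
    ∼⟨ §ᵇ^-≡-⇔ (instF-unboxed φ F₁) (instF-unboxed φ F₂)
               (λ b₁≡1 → 1≤i⇒1≤∣i∣ (1≤c₁ b₁≡1)) (λ b₂≡1 → 1≤i⇒1≤∣i∣ (1≤c₂ b₂≡1)) ⟩
  (φb φ b₁ ≡ φb φ b₂ × (∣ evalC φ c₁ ∣) ≡ (∣ evalC φ c₂ ∣) × instF φ F₁ ≡ instF φ F₂)
    ∼⟨ ⇔.refl ×-⇔ ∣i∣≡∣j∣⇔i≡j 0≤c₁ 0≤c₂ ×-⇔ ⇔.refl ⟩
  (φb φ b₁ ≡ φb φ b₂ × evalC φ c₁ ≡ evalC φ c₂ × instF φ F₁ ≡ instF φ F₂) ∎
  where open EquationalReasoning

Solution-∷-⇔ : ∀ {k C} → (Sat φ k × Solution φ C) ⇔ Solution φ (k ∷ C)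
Solution-∷-⇔ = mk⇔ (uncurry _∷_) uncons

Characterises : {P T : Set} → (P → P → Maybe (List Constraint)) →
  (Inst → P → Set) → (Inst → P → T) → P → P → Set
Characterises 𝒰 Adm inst E₁ E₂ = ∃ λ (C : List Constraint) → (𝒰 E₁ E₂ ≡ just C) ×
  ((φ : Inst) → Adm φ E₁ → Adm φ E₂ → (inst φ E₁ ≡ inst φ E₂) ⇔ Solution φ C)

mutual
  𝒰F-characterises : ∀ F₁ F₂ → eraseF F₁ ≡ eraseF F₂ →
    Characterises 𝒰F AdmF instF F₁ F₂
  𝒰F-characterises (pvar α) (pvar .α) refl with α ≟ α
  ... | yes _  = [] , refl , λ _ _ _ → mk⇔ (λ _ → []) (λ _ → refl)
  ... | no α≢α = contradiction refl α≢α
  𝒰F-characterises (D₁ ⊸ₚ A₁) (D₂ ⊸ₚ A₂) e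
    with 𝒰D-characterises D₁ D₂ (proj₁ (⇒-injective e))
       | 𝒰A-characterises A₁ A₂ (proj₂ (⇒-injective e))
  ... | C₁ , 𝒰D≡C₁ , hD | C₂ , 𝒰A≡C₂ , hA rewrite 𝒰D≡C₁ | 𝒰A≡C₂ =
    C₁ ++ C₂ , refl , λ φ (d₁ , a₁) (d₂ , a₂) → ⇔.trans ⊸-≡-⇔
      (⇔.trans (hD φ d₁ d₂ ×-⇔ hA φ a₁ a₂) (↔⇒⇔ ++↔))
  𝒰F-characterises (pall α A₁) (pall β A₂) e with all-injective e
  ... | refl , eA with α ≟ α
  ...   | no α≢α = contradiction refl α≢α
  ...   | yes _ with 𝒰A-characterises A₁ A₂ eA
  ...     | C , 𝒰A≡C , hA = C , 𝒰A≡C , λ φ a₁ a₂ → ⇔.trans tall-≡-⇔ (hA φ a₁ a₂)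
  𝒰F-characterises (pvar _)   (_ ⊸ₚ _)   ()
  𝒰F-characterises (pvar _)   (pall _ _) ()
  𝒰F-characterises (_ ⊸ₚ _)   (pvar _)   ()
  𝒰F-characterises (_ ⊸ₚ _)   (pall _ _) ()
  𝒰F-characterises (pall _ _) (pvar _)   ()
  𝒰F-characterises (pall _ _) (_ ⊸ₚ _)   ()

  𝒰A-characterises : ∀ A₁ A₂ → eraseA A₁ ≡ eraseA A₂ →
    Characterises 𝒰A AdmA instA A₁ A₂
  𝒰A-characterises (§ᶜ c₁ F₁) (§ᶜ c₂ F₂) e with 𝒰F-characterises F₁ F₂ e
  ... | C , 𝒰F≡C , hF rewrite 𝒰F≡C =
    eqC c₁ c₂ ∷ C , refl , λ φ (0≤c₁ , a₁) (0≤c₂ , a₂) →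
      ⇔.trans (instA-≡-⇔ {c₁ = c₁} {c₂ = c₂} 0≤c₁ 0≤c₂)
        (⇔.trans (⇔.refl ×-⇔ hF φ a₁ a₂) Solution-∷-⇔)

  𝒰D-characterises : ∀ D₁ D₂ → eraseD D₁ ≡ eraseD D₂ →
    Characterises 𝒰D AdmD instD D₁ D₂
  𝒰D-characterises (§ᵇᶜ b₁ c₁ F₁) (§ᵇᶜ b₂ c₂ F₂) e with 𝒰F-characterises F₁ F₂ e
  ... | C , 𝒰F≡C , hF rewrite 𝒰F≡C =
    eqB b₁ b₂ ∷ eqC c₁ c₂ ∷ C , refl , λ φ d₁@(_ , _ , a₁) d₂@(_ , _ , a₂) →
      ⇔.trans (instD-≡-⇔ d₁ d₂)
        (⇔.trans (⇔.refl ×-⇔ ⇔.refl ×-⇔ hF φ a₁ a₂)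
          (⇔.trans (⇔.refl ×-⇔ Solution-∷-⇔) Solution-∷-⇔))

lemma4p3 :
    ((E₁ E₂ : PA) → eraseA E₁ ≡ eraseA E₂ →
      ∃ λ (C : List Constraint) → (𝒰A E₁ E₂ ≡ just C) ×
        ((φ : Inst) → AdmA φ E₁ → AdmA φ E₂ →
          (instA φ E₁ ≡ instA φ E₂) ⇔ Solution φ C))
    ×
    ((E₁ E₂ : PD) → eraseD E₁ ≡ eraseD E₂ →
      ∃ λ (C : List Constraint) → (𝒰D E₁ E₂ ≡ just C) ×
        ((φ : Inst) → AdmD φ E₁ → AdmD φ E₂ →
          (instD φ E₁ ≡ instD φ E₂) ⇔ Solution φ C))
lemma4p3 = 𝒰A-characterises , 𝒰D-characterises
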